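{- For any uniform (deterministic) content-oblivious leader election algorithm, each solitude pattern is unique: for any pair of distinct IDs $i\neq j$, we have $p_i\neq p_j$.
   Context: Content-oblivious model on oriented rings: nodes have two ports (clockwise, CW, and counterclockwise, CCW); messages are content-free pulses; asynchronous delivery with arbitrary finite delays, no loss or injection; nodes are event-driven and act only based on their ID and the sequence of received pulses with their direction. Uniform: nodes do not know the ring size. Leader election: every node terminates with output Leader or Non-Leader, exactly one node outputting Leader. Solitude pattern: fix the algorithm and consider a ring with a single node ($n=1$), whose CW port is connected to its own CCW port. Take the scheduler that delivers pulses one by one in the order in which they were sent (ties broken by prioritizing CW pulses). The solitude pattern is the sequence of incoming pulses observed by the node, encoded as a binary string in which 0 encodes a CW pulse and 1 a CCW pulse. $p_i$ denotes the solitude pattern of a node with ID $i$. -}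

module Defs where

open import Data.Nat using (ℕ; zero; suc; _+_; _<_; _≤_)
open import Data.Nat.DivMod using (_%_; m%n<n)
open import Data.Fin using (Fin; toℕ; fromℕ<; _≟_)
open import Data.List using (List; []; _∷_; _∷ʳ_; _++_; replicate)
open import Data.Maybe using (Maybe; just; nothing; is-just)
open import Data.Bool using (Bool; true; false; if_then_else_)
open import Data.Product using (_×_; _,_; proj₁; proj₂; ∃; Σ)
open import Relation.Nullary using (¬_; yes; no)
open import Relation.Binary.PropositionalEquality using (_≡_; _≢_)
open import Function.Definitions using (Injective)

data Port : Set where
  cw ccw : Port

_≟P_ : (p q : Port) → Relation.Nullary.Dec (p ≡ q)
cw  ≟P cw  = yes _≡_.refl
cw  ≟P ccw = no λ ()
ccw ≟P cw  = no λ ()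
ccw ≟P ccw = yes _≡_.refl

-- A pulse sent on port p arrives at the opposite port of the neighbour.
opposite : Port → Port
opposite cw  = ccw
opposite ccw = cw

data Output : Set where
  Leader NonLeader : Output

-- Its behaviour depends only on the node's ID and the sequence of
-- received pulses (recorded by the port on which they arrived).  The
-- ring size is not an input (uniformity).
--
--  * send i h = (a , b): after having received the sequence h
--    (h = [] is the wake-up event; otherwise the last element of h is the
--    pulse just received), node i sends a pulses on its CW port and then
--    b pulses on its CCW port.
--  * decide i h: if just o, the node terminates with output o right after
--    this event (after performing the sends of this event).  A terminated
--    node ignores all further pulses (they are not observed).

record Algorithm : Set where
  field
    send   : ℕ → List Port → ℕ × ℕ
    decide : ℕ → List Port → Maybe Output

module _ (A : Algorithm) where
  open Algorithm A

  terminated : ℕ → List Port → Bool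
  terminated i h = is-just (decide i h)

  -- Executions on an oriented ring of size suc m.  Node k's CW port is
  -- connected to the CCW port of node k+1 (mod n).

  module Ring (m : ℕ) (ids : Fin (suc m) → ℕ) where

    next : Fin (suc m) → Fin (suc m)
    next k = fromℕ< (m%n<n (suc (toℕ k)) (suc m))

    prev : Fin (suc m) → Fin (suc m)
    prev k = fromℕ< (m%n<n (toℕ k + m) (suc m))

    -- A configuration: the observed history of each node and the number
    -- of pulses in transit towards each (node, arrival port).
    record Config : Set where
      field
        hist : Fin (suc m) → List Port
        pend : Fin (suc m) → Port → ℕ
    open Config public

    initial : Config
    initial = record
      { hist = λ _ → []
      ; pend = λ { k ccw → proj₁ (send (ids (prev k)) [])
                 ; k cw  → proj₂ (send (ids (next k)) []) } }

    setP : (Fin (suc m) → Port → ℕ) → Fin (suc m) → Port → ℕ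
         → Fin (suc m) → Port → ℕ
    setP f k p v k' p' with k' ≟ k | p' ≟P p
    ... | yes _ | yes _ = v
    ... | _     | _     = f k' p'

    addP : (Fin (suc m) → Port → ℕ) → Fin (suc m) → Port → ℕ
         → Fin (suc m) → Port → ℕ
    addP f k p v = setP f k p (f k p + v)

    setH : (Fin (suc m) → List Port) → Fin (suc m) → List Port
         → Fin (suc m) → List Port
    setH f k v k' with k' ≟ k
    ... | yes _ = v
    ... | no  _ = f k'

    deliver : Config → Fin (suc m) → Port → Config
    deliver c k p with pend c k p
    ... | zero  = c
    ... | suc r =
      if terminated (ids k) (hist c k)
      then record { hist = hist c ; pend = setP (pend c) k p r }
      else record
        { hist = setH (hist c) k (hist c k ∷ʳ p)
        ; pend = addP (addP (setP (pend c) k p r)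
                        (next k) ccw (proj₁ (send (ids k) (hist c k ∷ʳ p))))
                        (prev k) cw  (proj₂ (send (ids k) (hist c k ∷ʳ p))) }

    -- An (adaptive w.l.o.g., since everything is deterministic) schedule.
    Schedule : Set
    Schedule = ℕ → Fin (suc m) × Port

    exec : Schedule → ℕ → Config
    exec s zero    = initial
    exec s (suc t) = deliver (exec s t) (proj₁ (s t)) (proj₂ (s t))

    Fair : Schedule → Set
    Fair s = ∀ t k p → 0 < pend (exec s t) k p →
             ∃ λ t' → t ≤ t' × s t' ≡ (k , p)

    Elected : Config → Set
    Elected c = ∃ λ ℓ → decide (ids ℓ) (hist c ℓ) ≡ just Leader ×
                (∀ k → k ≢ ℓ → decide (ids k) (hist c k) ≡ just NonLeader)

  IsLeaderElection : Set
  IsLeaderElection =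
    ∀ m (ids : Fin (suc m) → ℕ) → Injective _≡_ _≡_ ids →
    ∀ (s : Ring.Schedule m ids) → Ring.Fair m ids s →
    ∃ λ t → Ring.Elected m ids (Ring.exec m ids s t)

  -- Solitude: single node with ID i, CW port wired to its own CCW port,
  -- FIFO delivery in order of sending (CW before CCW within an event).
  -- State: observed history and FIFO queue of in-transit pulses, each
  -- recorded by the port it was sent on.

  pulses : ℕ × ℕ → List Port
  pulses (a , b) = replicate a cw ++ replicate b ccw

  soloStep : ℕ → List Port × List Port → List Port × List Port
  soloStep i (h , [])    = (h , [])
  soloStep i (h , d ∷ q) =
    if terminated i h
    then (h , q)
    else (h ∷ʳ opposite d , q ++ pulses (send i (h ∷ʳ opposite d)))

  soloState : ℕ → ℕ → List Port × List Port
  soloState i zero    = ([] , pulses (send i []))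
  soloState i (suc t) = soloStep i (soloState i t)

  -- Prefix of the solitude pattern p_i observed after t deliveries.
  -- The solitude pattern is the limit of these (monotone) prefixes.
  soloPrefix : ℕ → ℕ → List Port
  soloPrefix i t = proj₁ (soloState i t)

  SamePattern : ℕ → ℕ → Set
  SamePattern i j = ∀ t → soloPrefix i t ≡ soloPrefix j t

-- In solitude a node with ID i runs a one-node ring under a fair schedule, so it must eventually
-- decide, and its decision is Leader; since a terminated node's history never changes, every
-- decision it ever makes in solitude is Leader. Suppose p_i = p_j. Put i and j on a two-node ring
-- and let the nodes receive alternately, each the head of the other's solitary queue. Whether a
-- solitary node terminates at a step, and which pulse it receives, can be read off its pattern, so
-- equal patterns keep the two solitary runs in lockstep: both nodes then follow their solitary
-- histories and eventually both decide Leader, contradicting correctness of the election.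
module Submission where

open import Data.Bool using (true; false)
open import Data.Empty using (⊥; ⊥-elim)
open import Data.Fin using (Fin; zero; suc; _≟_)
open import Data.List using (List; []; _∷_; _∷ʳ_; _++_; length; drop)
open import Data.List.Properties using (++-assoc; ++-identityʳ; ∷ʳ-injective; length-++)
open import Data.Maybe using (just; is-just)
open import Data.Nat using (ℕ; zero; suc; _+_; _<_; _≤_)
open import Data.Nat.Properties
  using ( m≤m+n; m≤n+m; n≤1+n; ≤-refl; ≤-reflexive; ≤-trans; m≤n⇒m≤1+n; <-≤-trans
        ; +-comm; +-suc; m+1+n≢m)
open import Data.Product using (_×_; _,_; proj₁; proj₂; ∃; ∃₂)
open import Data.Product.Properties using (≡-dec)
open import Function using (_∘_)
open import Relation.Nullary using (¬_; yes; no; contradiction)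
open import Relation.Binary.PropositionalEquality

open import Defs

xs∷ʳx≢xs : ∀ {a} {A : Set a} (xs : List A) x → xs ∷ʳ x ≢ xs
xs∷ʳx≢xs xs x eq = m+1+n≢m (length xs) (trans (sym (length-++ xs)) (cong length eq))

opposite-injective : ∀ {p q} → opposite p ≡ opposite q → p ≡ q
opposite-injective {cw}  {cw}  _ = refl
opposite-injective {ccw} {ccw} _ = refl

-- Queues record the port a pulse was sent on; the pulse arrives at the opposite port.
arrivals : Port → List Port → ℕ
arrivals p   []        = 0
arrivals cw  (cw  ∷ q) = arrivals cw q
arrivals cw  (ccw ∷ q) = suc (arrivals cw q)
arrivals ccw (cw  ∷ q) = suc (arrivals ccw q)
arrivals ccw (ccw ∷ q) = arrivals ccw q

-- The value on the empty queue is junk: delivering at a port with nothing pending is a no-op.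
nextArrival : List Port → Port
nextArrival []      = cw
nextArrival (d ∷ _) = opposite d

arrivals-++ : ∀ p xs ys → arrivals p (xs ++ ys) ≡ arrivals p xs + arrivals p ys
arrivals-++ p   []         ys = refl
arrivals-++ cw  (cw  ∷ xs) ys = arrivals-++ cw xs ys
arrivals-++ cw  (ccw ∷ xs) ys = cong suc (arrivals-++ cw xs ys)
arrivals-++ ccw (cw  ∷ xs) ys = cong suc (arrivals-++ ccw xs ys)
arrivals-++ ccw (ccw ∷ xs) ys = arrivals-++ ccw xs ys

arrivals-nextArrival : ∀ d q → arrivals (opposite d) (d ∷ q) ≡ suc (arrivals (opposite d) q)
arrivals-nextArrival cw  q = refl
arrivals-nextArrival ccw q = refl

arrivals-ccw-pulses : ∀ A a b → arrivals ccw (pulses A (a , b)) ≡ a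
arrivals-ccw-pulses A (suc a) b       = cong suc (arrivals-ccw-pulses A a b)
arrivals-ccw-pulses A zero    zero    = refl
arrivals-ccw-pulses A zero    (suc b) = arrivals-ccw-pulses A zero b

arrivals-cw-pulses : ∀ A a b → arrivals cw (pulses A (a , b)) ≡ b
arrivals-cw-pulses A (suc a) b       = arrivals-cw-pulses A a b
arrivals-cw-pulses A zero    zero    = refl
arrivals-cw-pulses A zero    (suc b) = cong suc (arrivals-cw-pulses A zero b)

arrivals-split : ∀ p q → 0 < arrivals p q →
                 ∃₂ λ ys zs → ∃ λ d → q ≡ ys ++ d ∷ zs × opposite d ≡ p
arrivals-split cw  (ccw ∷ q) _ = [] , q , ccw , refl , refl
arrivals-split ccw (cw  ∷ q) _ = [] , q , cw , refl , refl
arrivals-split cw  (cw  ∷ q) pos with arrivals-split cw q pos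
... | ys , zs , d , refl , o = cw ∷ ys , zs , d , refl , o
arrivals-split ccw (ccw ∷ q) pos with arrivals-split ccw q pos
... | ys , zs , d , refl , o = ccw ∷ ys , zs , d , refl , o

other : Fin 2 → Fin 2
other zero       = suc zero
other (suc zero) = zero

other-≢ : ∀ k → other k ≢ k
other-≢ zero       ()
other-≢ (suc zero) ()

double : ℕ → ℕ
double zero    = zero
double (suc u) = suc (suc (double u))

double≡+ : ∀ u → double u ≡ u + u
double≡+ zero    = refl
double≡+ (suc u) = cong suc (trans (cong suc (double≡+ u)) (sym (+-suc u u)))

double-mono : ∀ n u → double u ≤ double (n + u)
double-mono zero    u = ≤-refl
double-mono (suc n) u = m≤n⇒m≤1+n (m≤n⇒m≤1+n (double-mono n u))

turn : Fin 2 → ℕ → ℕ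
turn zero       u = double u
turn (suc zero) u = suc (double u)

double≤turn : ∀ k n u → double u ≤ turn k (n + u)
double≤turn zero       n u = double-mono n u
double≤turn (suc zero) n u = m≤n⇒m≤1+n (double-mono n u)

every-time-is-a-turn : ∀ t → ∃₂ λ k u → t ≡ turn k u
every-time-is-a-turn zero          = zero , zero , refl
every-time-is-a-turn (suc zero)    = suc zero , zero , refl
every-time-is-a-turn (suc (suc t)) with every-time-is-a-turn t
... | zero     , u , refl = zero , suc u , refl
... | suc zero , u , refl = suc zero , suc u , refl

alternate : (Fin 2 → ℕ → Port) → ℕ → Fin 2 × Port
alternate f zero          = zero , f zero 0
alternate f (suc zero)    = suc zero , f (suc zero) 0
alternate f (suc (suc t)) = alternate (λ k → f k ∘ suc) t

alternate-turn : ∀ f k u → alternate f (turn k u) ≡ (k , f k u)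
alternate-turn f zero       zero    = refl
alternate-turn f (suc zero) zero    = refl
alternate-turn f zero       (suc u) = alternate-turn (λ k → f k ∘ suc) zero u
alternate-turn f (suc zero) (suc u) = alternate-turn (λ k → f k ∘ suc) (suc zero) u

module _ (A : Algorithm) where
  open Algorithm A

  module Solitude (i : ℕ) where

    history : ℕ → List Port
    history = soloPrefix A i

    queue : ℕ → List Port
    queue t = proj₂ (soloState A i t)

    soloStep-terminated : ∀ {h} q → terminated A i h ≡ true → soloStep A i (h , q) ≡ (h , drop 1 q)
    soloStep-terminated []      term = refl
    soloStep-terminated (_ ∷ _) term rewrite term = refl

    soloStep-live : ∀ {h d q} → terminated A i h ≡ false →
                    soloStep A i (h , d ∷ q) ≡ (h ∷ʳ opposite d , q ++ pulses A (send i (h ∷ʳ opposite d)))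
    soloStep-live live rewrite live = refl

    step-idle : ∀ t → queue t ≡ [] → soloState A i (suc t) ≡ soloState A i t
    step-idle t e = trans (cong (λ q → soloStep A i (history t , q)) e) (cong (history t ,_) (sym e))

    step-terminated : ∀ t → terminated A i (history t) ≡ true →
                      soloState A i (suc t) ≡ (history t , drop 1 (queue t))
    step-terminated t = soloStep-terminated (queue t)

    step-live : ∀ t {d q} → queue t ≡ d ∷ q → terminated A i (history t) ≡ false →
                soloState A i (suc t) ≡
                  (history t ∷ʳ opposite d , q ++ pulses A (send i (history t ∷ʳ opposite d)))
    step-live t e live = trans (cong (λ q → soloStep A i (history t , q)) e) (soloStep-live live)

    history-stable : ∀ {t} → terminated A i (history t) ≡ true → ∀ n → history (n + t) ≡ history t
    history-stable term zero    = refl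
    history-stable {t} term (suc n) =
      trans (cong proj₁ (step-terminated (n + t)
                                         (subst (λ h → terminated A i h ≡ true) (sym stable) term)))
            stable
      where stable = history-stable term n

    idle-state-stable : ∀ {t} → queue t ≡ [] → ∀ n → soloState A i (n + t) ≡ soloState A i t
    idle-state-stable e zero        = refl
    idle-state-stable {t} e (suc n) =
      trans (step-idle (n + t) (trans (cong proj₂ stable) e)) stable
      where stable = idle-state-stable e n

    queue-extends : ∀ t {d q} → queue t ≡ d ∷ q → ∃ λ X → queue (suc t) ≡ q ++ X
    queue-extends t e with terminated A i (history t) in term
    ... | true  = [] , trans (cong proj₂ (step-terminated t term))
                             (trans (cong (drop 1) e) (sym (++-identityʳ _)))
    ... | false = _ , cong proj₂ (step-live t e term)

    queue-fifo : ∀ t ys d zs → queue t ≡ ys ++ d ∷ zs → ∃ λ w → queue (length ys + t) ≡ d ∷ w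
    queue-fifo t []       d zs e = zs , e
    queue-fifo t (y ∷ ys) d zs e with queue-extends t e
    ... | X , e′ with queue-fifo (suc t) ys d (zs ++ X) (trans e′ (++-assoc ys (d ∷ zs) X))
    ... | w , e″ = w , trans (cong queue (sym (+-suc (length ys) t))) e″

    arrival-reaches-head : ∀ t {p} → 0 < arrivals p (queue t) → ∃ λ n → nextArrival (queue (n + t)) ≡ p
    arrival-reaches-head t {p} pos with arrivals-split p (queue t) pos
    ... | ys , zs , d , e , o with queue-fifo t ys d zs e
    ... | w , e′ = length ys , trans (cong nextArrival e′) o

  open Solitude

  terminated-live-conflict : ∀ {x y} → SamePattern A x y → ∀ t {d q} →
                             terminated A x (history x t) ≡ true →
                             queue y t ≡ d ∷ q → terminated A y (history y t) ≡ false → ⊥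
  terminated-live-conflict {x} {y} same t {d} term e live = xs∷ʳx≢xs (history y t) (opposite d) (begin
    history y t ∷ʳ opposite d  ≡⟨ cong proj₁ (step-live y t e live) ⟨
    history y (suc t)          ≡⟨ same (suc t) ⟨
    history x (suc t)          ≡⟨ cong proj₁ (step-terminated x t term) ⟩
    history x t                ≡⟨ same t ⟩
    history y t                ∎)
    where open ≡-Reasoning

  receive-same-pulse : ∀ {x y} → SamePattern A x y → ∀ t {d d′ q q′} →
                       queue x t ≡ d ∷ q → terminated A x (history x t) ≡ false →
                       queue y t ≡ d′ ∷ q′ → terminated A y (history y t) ≡ false → d ≡ d′
  receive-same-pulse {x} {y} same t {d} {d′} ex lx ey ly =
    opposite-injective (proj₂ (∷ʳ-injective (history x t) (history y t) (begin
      history x t ∷ʳ opposite d   ≡⟨ cong proj₁ (step-live x t ex lx) ⟨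
      history x (suc t)           ≡⟨ same (suc t) ⟩
      history y (suc t)           ≡⟨ cong proj₁ (step-live y t ey ly) ⟩
      history y t ∷ʳ opposite d′  ∎)))
    where open ≡-Reasoning

  module Delivery (m : ℕ) (ids : Fin (suc m) → ℕ) where
    open Ring A m ids

    setP-same : ∀ f k p v → setP f k p v k p ≡ v
    setP-same f k p v with k ≟ k | p ≟P p
    ... | yes _  | yes _  = refl
    ... | no k≢k | _      = contradiction refl k≢k
    ... | yes _  | no p≢p = contradiction refl p≢p

    setP-other : ∀ f k p v {k′ p′} → (k′ , p′) ≢ (k , p) → setP f k p v k′ p′ ≡ f k′ p′
    setP-other f k p v {k′} {p′} ne with k′ ≟ k | p′ ≟P p
    ... | yes refl | yes refl = contradiction refl ne
    ... | yes _    | no _     = refl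
    ... | no _     | _        = refl

    setH-same : ∀ f k v → setH f k v k ≡ v
    setH-same f k v with k ≟ k
    ... | yes _  = refl
    ... | no k≢k = contradiction refl k≢k

    setH-other : ∀ f k v {k′} → k′ ≢ k → setH f k v k′ ≡ f k′
    setH-other f k v {k′} k′≢k with k′ ≟ k
    ... | yes k′≡k = contradiction k′≡k k′≢k
    ... | no _     = refl

    addP-≥ : ∀ f k p v k′ p′ → f k′ p′ ≤ addP f k p v k′ p′
    addP-≥ f k p v k′ p′ with k′ ≟ k | p′ ≟P p
    ... | yes refl | yes refl = m≤m+n _ _
    ... | yes _    | no _     = ≤-refl
    ... | no _     | _        = ≤-refl

    addP-pulses : ∀ f n a b p → addP (addP f n ccw a) n cw b n p ≡ f n p + arrivals p (pulses A (a , b))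
    addP-pulses f n a b cw = begin
      addP (addP f n ccw a) n cw b n cw  ≡⟨ setP-same _ n cw _ ⟩
      addP f n ccw a n cw + b            ≡⟨ cong (_+ b) (setP-other f n ccw _ λ ()) ⟩
      f n cw + b                         ≡⟨ cong (f n cw +_) (arrivals-cw-pulses A a b) ⟨
      f n cw + arrivals cw (pulses A (a , b)) ∎
      where open ≡-Reasoning
    addP-pulses f n a b ccw = begin
      addP (addP f n ccw a) n cw b n ccw ≡⟨ setP-other (addP f n ccw a) n cw _ {n} {ccw} (λ ()) ⟩
      addP f n ccw a n ccw               ≡⟨ setP-same f n ccw _ ⟩
      f n ccw + a                        ≡⟨ cong (f n ccw +_) (arrivals-ccw-pulses A a b) ⟨
      f n ccw + arrivals ccw (pulses A (a , b)) ∎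
      where open ≡-Reasoning

    addP-elsewhere : ∀ f n a b {k′} p → k′ ≢ n → addP (addP f n ccw a) n cw b k′ p ≡ f k′ p
    addP-elsewhere f n a b p k′≢n = trans (setP-other (addP f n ccw a) n cw _ {p′ = p} (k′≢n ∘ cong proj₁))
                                          (setP-other f n ccw _ (k′≢n ∘ cong proj₁))

    deliver-empty : ∀ {c k p} → pend c k p ≡ 0 → deliver c k p ≡ c
    deliver-empty {c} {k} {p} e with pend c k p
    deliver-empty refl | .0 = refl

    deliver-dropped : ∀ {c k p r} → pend c k p ≡ suc r → terminated A (ids k) (hist c k) ≡ true →
                      deliver c k p ≡ record { hist = hist c ; pend = setP (pend c) k p r }
    deliver-dropped {c} {k} {p} e term with pend c k p
    deliver-dropped refl term | .(suc _) rewrite term = refl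

    deliver-received : ∀ {c k p r} → pend c k p ≡ suc r → terminated A (ids k) (hist c k) ≡ false →
      deliver c k p ≡ record
        { hist = setH (hist c) k (hist c k ∷ʳ p)
        ; pend = addP (addP (setP (pend c) k p r)
                        (next k) ccw (proj₁ (send (ids k) (hist c k ∷ʳ p))))
                        (prev k) cw  (proj₂ (send (ids k) (hist c k ∷ʳ p))) }
    deliver-received {c} {k} {p} e live with pend c k p
    deliver-received refl live | .(suc _) rewrite live = refl

    deliver-pend-≥ : ∀ c k p {k′ p′} → (k′ , p′) ≢ (k , p) → pend c k′ p′ ≤ pend (deliver c k p) k′ p′
    deliver-pend-≥ c k p {k′} {p′} ne = go (pend c k p) refl (terminated A (ids k) (hist c k)) refl
      where
      go : ∀ n → pend c k p ≡ n → ∀ b → terminated A (ids k) (hist c k) ≡ b →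
           pend c k′ p′ ≤ pend (deliver c k p) k′ p′
      go zero    e _     _    rewrite deliver-empty {c} {k} e = ≤-refl
      go (suc r) e true  term rewrite deliver-dropped {c} {k} e term =
        ≤-reflexive (sym (setP-other (pend c) k p r ne))
      go (suc r) e false live rewrite deliver-received {c} {k} e live =
        ≤-trans (≤-reflexive (sym (setP-other (pend c) k p r ne)))
                (≤-trans (addP-≥ _ _ _ _ k′ p′) (addP-≥ _ _ _ _ k′ p′))

    deliver-hist-terminated : ∀ c k p → terminated A (ids k) (hist c k) ≡ true →
                              hist (deliver c k p) ≡ hist c
    deliver-hist-terminated c k p term = go (pend c k p) refl
      where
      go : ∀ n → pend c k p ≡ n → hist (deliver c k p) ≡ hist c
      go zero    e = cong hist (deliver-empty {c} {k} e)
      go (suc r) e = cong hist (deliver-dropped {c} {k} e term)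

    Elected⇒terminated : ∀ {c} → Elected c → ∀ k → terminated A (ids k) (hist c k) ≡ true
    Elected⇒terminated (ℓ , leader , others) k with k ≟ ℓ
    ... | yes refl = cong is-just leader
    ... | no k≢ℓ   = cong is-just (others k k≢ℓ)

    deliver-preserves-Elected : ∀ c k p → Elected c → Elected (deliver c k p)
    deliver-preserves-Elected c k p el
      rewrite deliver-hist-terminated c k p (Elected⇒terminated {c} el k) = el

    Elected-persists : ∀ s t n → Elected (exec s t) → Elected (exec s (n + t))
    Elected-persists s t zero    el = el
    Elected-persists s t (suc n) el =
      deliver-preserves-Elected (exec s (n + t)) (proj₁ (s (n + t))) (proj₂ (s (n + t)))
                                (Elected-persists s t n el)

    record Mirrors (c : Config) (k : Fin (suc m)) (h q : List Port) : Set where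
      constructor mirrors
      field
        hist≡ : hist c k ≡ h
        pend≡ : ∀ p → pend c k p ≡ arrivals p q

    Mirrors-cong : ∀ {c c′ k h h′ q q′} → c ≡ c′ → h ≡ h′ → q ≡ q′ → Mirrors c k h q → Mirrors c′ k h′ q′
    Mirrors-cong refl refl refl mir = mir

    initial-mirrors : ∀ {k n} → next k ≡ n → prev k ≡ n → Mirrors initial k [] (pulses A (send (ids n) []))
    initial-mirrors {n = n} nk pk = mirrors refl λ
      { cw  → trans (cong (λ k → proj₂ (send (ids k) [])) nk) (sym (arrivals-cw-pulses A (proj₁ sent) _))
      ; ccw → trans (cong (λ k → proj₁ (send (ids k) [])) pk) (sym (arrivals-ccw-pulses A _ (proj₂ sent))) }
      where sent = send (ids n) []

    head-consumed : ∀ f k {d q} → (∀ p → f k p ≡ arrivals p (d ∷ q)) →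
                    ∀ p → setP f k (opposite d) (arrivals (opposite d) q) k p ≡ arrivals p q
    head-consumed f k {cw}  _  ccw = setP-same f k ccw _
    head-consumed f k {ccw} _  cw  = setP-same f k cw _
    head-consumed f k {cw}  ep cw  = trans (setP-other f k ccw _ λ ()) (ep cw)
    head-consumed f k {ccw} ep ccw = trans (setP-other f k cw _ λ ()) (ep ccw)

    deliver-terminated : ∀ {c k h q} → Mirrors c k h q → terminated A (ids k) h ≡ true →
      let c′ = deliver c k (nextArrival q) in
      Mirrors c′ k h (drop 1 q) × (∀ {k′ h′ q′} → k′ ≢ k → Mirrors c k′ h′ q′ → Mirrors c′ k′ h′ q′)
    deliver-terminated {c} {k} {q = []} (mirrors eh ep) term
      rewrite deliver-empty {c} {k} (ep cw) = mirrors eh ep , λ _ mir → mir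
    deliver-terminated {c} {k} {h} {d ∷ q} (mirrors eh ep) term
      rewrite deliver-dropped {c} {k} (trans (ep (opposite d)) (arrivals-nextArrival d q))
                                      (trans (cong (terminated A (ids k)) eh) term) =
      mirrors eh (head-consumed (pend c) k ep) ,
      λ k′≢k (mirrors eh′ ep′) →
        mirrors eh′ λ p → trans (setP-other (pend c) k (opposite d) _ (k′≢k ∘ cong proj₁)) (ep′ p)

    module _ {c k n h d q} (nk : next k ≡ n) (pk : prev k ≡ n)
             (mir : Mirrors c k h (d ∷ q)) (live : terminated A (ids k) h ≡ false) where

      private
        open Mirrors mir
        h′ = h ∷ʳ opposite d
        sent = send (ids k) h′
        X = pulses A sent
        unfold = deliver-received {c} {k} (trans (pend≡ (opposite d)) (arrivals-nextArrival d q))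
                                          (trans (cong (terminated A (ids k)) hist≡) live)

      deliver-live-self : n ≡ k → Mirrors (deliver c k (opposite d)) k h′ (q ++ X)
      deliver-live-self refl rewrite unfold | nk | pk | hist≡ =
        mirrors (setH-same (hist c) k h′) λ p →
          trans (addP-pulses _ k (proj₁ sent) (proj₂ sent) p)
                (trans (cong (_+ arrivals p X) (head-consumed (pend c) k pend≡ p))
                       (sym (arrivals-++ p q X)))

      deliver-live-neighbour : n ≢ k → ∀ {h₂ q₂} → Mirrors c n h₂ q₂ →
        Mirrors (deliver c k (opposite d)) k h′ q × Mirrors (deliver c k (opposite d)) n h₂ (q₂ ++ X)
      deliver-live-neighbour n≢k {q₂ = q₂} (mirrors eh₂ ep₂) rewrite unfold | nk | pk | hist≡ =
        mirrors (setH-same (hist c) k h′)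
                (λ p → trans (addP-elsewhere _ n _ _ p (n≢k ∘ sym)) (head-consumed (pend c) k pend≡ p)) ,
        mirrors (trans (setH-other (hist c) k h′ n≢k) eh₂) λ p →
          trans (addP-pulses _ n (proj₁ sent) (proj₂ sent) p)
                (trans (cong (_+ arrivals p X)
                             (trans (setP-other (pend c) k (opposite d) _ (n≢k ∘ cong proj₁)) (ep₂ p)))
                       (sym (arrivals-++ p q₂ X)))

  module SolitaryRing (i : ℕ) where

    ids : Fin 1 → ℕ
    ids _ = i

    open Ring A 0 ids
    open Delivery 0 ids

    schedule : Schedule
    schedule t = zero , nextArrival (queue i t)

    round : ∀ c t → Mirrors c zero (history i t) (queue i t) →
            Mirrors (deliver c zero (nextArrival (queue i t))) zero (history i (suc t)) (queue i (suc t))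
    round c t mir with terminated A i (history i t) in term
    ... | true = Mirrors-cong refl (sym (cong proj₁ (step-terminated i t term)))
                                   (sym (cong proj₂ (step-terminated i t term)))
                                   (proj₁ (deliver-terminated mir term))
    ... | false with queue i t in e
    ...   | []    = Mirrors-cong (sym (deliver-empty {c} {zero} (Mirrors.pend≡ mir cw)))
                                 (sym (cong proj₁ (step-idle i t e)))
                                 (trans (sym e) (sym (cong proj₂ (step-idle i t e)))) mir
    ...   | d ∷ q = Mirrors-cong refl (sym (cong proj₁ (step-live i t e term)))
                                      (sym (cong proj₂ (step-live i t e term)))
                                      (deliver-live-self {c} {zero} refl refl mir term refl)

    simulates : ∀ t → Mirrors (exec schedule t) zero (history i t) (queue i t)
    simulates zero    = initial-mirrors refl refl
    simulates (suc t) = round (exec schedule t) t (simulates t)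

    fair : Fair schedule
    fair t zero p pos with arrival-reaches-head i t (subst (0 <_) (Mirrors.pend≡ (simulates t) p) pos)
    ... | n , head = n + t , m≤n+m t n , cong (zero ,_) head

    elects-itself : IsLeaderElection A → ∃ λ t → decide i (history i t) ≡ just Leader
    elects-itself election with election 0 ids (λ { {zero} {zero} _ → refl }) schedule fair
    ... | t , zero , leader , _ = t , trans (cong (decide i) (sym (Mirrors.hist≡ (simulates t)))) leader

  module _ (election : IsLeaderElection A) where

    open SolitaryRing using (elects-itself)

    terminated-histories-agree : ∀ i a b → terminated A i (history i a) ≡ true →
                                 terminated A i (history i b) ≡ true → history i a ≡ history i b
    terminated-histories-agree i a b ta tb = begin
      history i a        ≡⟨ history-stable i ta b ⟨
      history i (b + a)  ≡⟨ cong (history i) (+-comm b a) ⟩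
      history i (a + b)  ≡⟨ history-stable i tb a ⟩
      history i b        ∎
      where open ≡-Reasoning

    solitary-decision-Leader : ∀ i t {o} → decide i (history i t) ≡ just o → o ≡ Leader
    solitary-decision-Leader i t e with elects-itself i election
    ... | T , leader
      with trans (sym e) (trans (cong (decide i) (terminated-histories-agree i t T (cong is-just e)
                                                                                  (cong is-just leader)))
                                leader)
    ... | refl = refl

    idle⇒terminated : ∀ i t → queue i t ≡ [] → terminated A i (history i t) ≡ true
    idle⇒terminated i t idle with elects-itself i election
    ... | T , leader = subst (λ h → terminated A i h ≡ true) T≡t (cong is-just leader)
      where
      open ≡-Reasoning
      T≡t : history i T ≡ history i t
      T≡t = begin
        history i T        ≡⟨ history-stable i (cong is-just leader) t ⟨
        history i (t + T)  ≡⟨ cong (history i) (+-comm t T) ⟩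
        history i (T + t)  ≡⟨ cong proj₁ (idle-state-stable i idle T) ⟩
        history i t        ∎

    data SoloMove (i t : ℕ) : Set where
      done     : terminated A i (history i t) ≡ true → SoloMove i t
      receives : ∀ d q → queue i t ≡ d ∷ q → terminated A i (history i t) ≡ false → SoloMove i t

    soloMove : ∀ i t → SoloMove i t
    soloMove i t with terminated A i (history i t) in term | queue i t in e
    ... | true  | _     = done term
    ... | false | []    with () ← trans (sym term) (idle⇒terminated i t e)
    ... | false | d ∷ q = receives d q e term

    data Lockstep (i j t : ℕ) : Set where
      both-terminated : terminated A i (history i t) ≡ true → terminated A j (history j t) ≡ true →
                        Lockstep i j t
      both-receive    : ∀ d qi qj → queue i t ≡ d ∷ qi → queue j t ≡ d ∷ qj →
                        terminated A i (history i t) ≡ false → terminated A j (history j t) ≡ false →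
                        Lockstep i j t

    lockstep : ∀ {i j} → SamePattern A i j → ∀ t → Lockstep i j t
    lockstep {i} {j} same t with soloMove i t | soloMove j t
    ... | done ti             | done tj             = both-terminated ti tj
    ... | done ti             | receives _ _ ej lj  = ⊥-elim (terminated-live-conflict same t ti ej lj)
    ... | receives _ _ ei li  | done tj             = ⊥-elim (terminated-live-conflict (sym ∘ same) t tj ei li)
    ... | receives d qi ei li | receives _ qj ej lj with receive-same-pulse same t ei li ej lj
    ...   | refl = both-receive d qi qj ei ej li lj

    module PairRing {i j : ℕ} (i≢j : i ≢ j) (same : SamePattern A i j) where

      ids : Fin 2 → ℕ
      ids zero       = i
      ids (suc zero) = j

      ids-injective : ∀ {k k′} → ids k ≡ ids k′ → k ≡ k′
      ids-injective {zero}     {zero}     _ = refl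
      ids-injective {zero}     {suc zero} e = contradiction e i≢j
      ids-injective {suc zero} {zero}     e = contradiction (sym e) i≢j
      ids-injective {suc zero} {suc zero} _ = refl

      open Ring A 1 ids
      open Delivery 1 ids

      next≡other : ∀ k → next k ≡ other k
      next≡other zero       = refl
      next≡other (suc zero) = refl

      prev≡other : ∀ k → prev k ≡ other k
      prev≡other zero       = refl
      prev≡other (suc zero) = refl

      -- Node k follows the solitary history of its own ID but is fed the solitary queue of its
      -- neighbour's ID.
      PairMirrors : Config → ℕ → Set
      PairMirrors c t = ∀ k → Mirrors c k (history (ids k) t) (queue (ids (other k)) t)

      round : ∀ c t → PairMirrors c t →
              PairMirrors (deliver (deliver c zero (nextArrival (queue j t))) (suc zero) (nextArrival (queue i t)))
                          (suc t)
      round c t mir with lockstep same t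
      ... | both-terminated ti tj = λ
        { zero       → Mirrors-cong refl (sym (cong proj₁ (step-terminated i t ti)))
                                         (sym (cong proj₂ (step-terminated j t tj)))
                                         (proj₂ after-one (λ ()) (proj₁ after-zero))
        ; (suc zero) → Mirrors-cong refl (sym (cong proj₁ (step-terminated j t tj)))
                                         (sym (cong proj₂ (step-terminated i t ti))) (proj₁ after-one) }
        where
        after-zero = deliver-terminated (mir zero) ti
        after-one  = deliver-terminated (proj₂ after-zero (λ ()) (mir (suc zero))) tj
      ... | both-receive d qi qj ei ej li lj = λ
        { zero       → Mirrors-cong delivered (sym (cong proj₁ (step-live i t ei li)))
                                              (sym (cong proj₂ (step-live j t ej lj))) (proj₂ after-one)
        ; (suc zero) → Mirrors-cong delivered (sym (cong proj₁ (step-live j t ej lj)))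
                                              (sym (cong proj₂ (step-live i t ei li))) (proj₁ after-one) }
        where
        sent-by-i = pulses A (send i (history i t ∷ʳ opposite d))
        after-zero = deliver-live-neighbour {c} {zero} refl refl
                       (Mirrors-cong refl refl ej (mir zero)) li (λ ()) (mir (suc zero))
        after-one  = deliver-live-neighbour {k = suc zero} refl refl
                       (Mirrors-cong refl refl (cong (_++ sent-by-i) ei) (proj₂ after-zero)) lj (λ ())
                       (proj₁ after-zero)
        delivered = sym (cong₂ (λ a b → deliver (deliver c zero a) (suc zero) b)
                               (cong nextArrival ej) (cong nextArrival ei))

      feed : Fin 2 → ℕ → Port
      feed k = nextArrival ∘ queue (ids (other k))

      schedule : Schedule
      schedule = alternate feed

      simulates : ∀ t → PairMirrors (exec schedule (double t)) t
      simulates zero    k = initial-mirrors (next≡other k) (prev≡other k)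
      simulates (suc t) = subst (λ c → PairMirrors c (suc t)) (sym exec-round) (round _ t (simulates t))
        where
        exec-round : exec schedule (double (suc t)) ≡
                     deliver (deliver (exec schedule (double t)) zero (nextArrival (queue j t)))
                             (suc zero) (nextArrival (queue i t))
        exec-round rewrite alternate-turn feed zero t | alternate-turn feed (suc zero) t = refl

      fair-from-round-start : ∀ u k p → 0 < pend (exec schedule (double u)) k p →
                              ∃ λ t′ → double u ≤ t′ × schedule t′ ≡ (k , p)
      fair-from-round-start u k p pos
        with arrival-reaches-head (ids (other k)) u (subst (0 <_) (Mirrors.pend≡ (simulates u k) p) pos)
      ... | n , head = turn k (n + u) , double≤turn k n u ,
                       trans (alternate-turn feed k (n + u)) (cong (k ,_) head)

      fair : Fair schedule
      fair t k p pos with every-time-is-a-turn t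
      ... | zero     , u , refl = fair-from-round-start u k p pos
      ... | suc zero , u , refl with ≡-dec _≟_ _≟P_ (k , p) (schedule (suc (double u)))
      ...   | yes hit  = suc (double u) , ≤-refl , sym hit
      ...   | no  miss
        with fair-from-round-start (suc u) k p
               (<-≤-trans pos (deliver-pend-≥ (exec schedule (suc (double u))) _ _ miss))
      ...     | t′ , u≤t′ , hit = t′ , ≤-trans (n≤1+n _) u≤t′ , hit

      two-leaders : ⊥
      two-leaders with election 1 ids ids-injective schedule fair
      ... | t , elected
        with subst (Elected ∘ exec schedule) (sym (double≡+ t)) (Elected-persists schedule t t elected)
      ... | ℓ , _ , others
        with solitary-decision-Leader (ids (other ℓ)) t
               (trans (cong (decide (ids (other ℓ))) (sym (Mirrors.hist≡ (simulates t (other ℓ)))))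
                      (others (other ℓ) (other-≢ ℓ)))
      ... | ()

lemma5p3 : (A : Algorithm) → IsLeaderElection A →
    ∀ (i j : ℕ) → i ≢ j → ¬ SamePattern A i j
lemma5p3 A election i j i≢j same = PairRing.two-leaders A election i≢j same
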